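{- Let $M$ be a finite abelian group and $J$ a Jacobi function on $M$. For $\alpha \in M$ define $Q_\alpha \colon M \to \mathbf{C}$ by $Q_\alpha(\beta) = J(\alpha\beta^{ -1},\beta)$. Then $Q_\alpha \ast Q_\beta = Q_{\alpha\beta}$ for all $\alpha,\beta \in M$.
   Context: The convolution of $f,g\colon M\to\mathbf{C}$ is $(f\ast g)(\alpha)=\sum_{\alpha=\beta\gamma} f(\beta)g(\gamma)$. $\delta(\alpha)=1$ if $\alpha$ is the identity of $M$, else $0$. A Jacobi function on $M$ is a function $J \colon M\times M \to \mathbf{C}$ satisfying: (A) $J(\alpha,\beta)=J(\beta,\alpha)$; (B) with $J^*(\alpha,\beta)=J(\alpha,\beta)-\delta(\alpha)-\delta(\beta)$, $J^*(\alpha,\beta)J^*(\alpha\beta,\gamma)=J^*(\alpha,\beta\gamma)J^*(\beta,\gamma)$ for all $\alpha,\beta,\gamma$; (C) $\sum_{\beta\in M} J(\alpha_1\beta,\alpha_2\beta^{ -1})J(\alpha_3\beta,\alpha_4\beta^{ -1}) = J(\alpha_1\alpha_4,\alpha_2\alpha_3)$ for all $\alpha_1,\dots,\alpha_4 \in M$. -}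

module Defs where

open import Level using (Level; 0ℓ)
open import Data.Nat using (ℕ; zero; suc)
open import Data.Fin using (Fin; zero; suc)
open import Function.Bundles using (_↔_; Inverse)
open import Relation.Binary.PropositionalEquality using (_≡_)
open import Relation.Binary.Definitions using (DecidableEquality)
open import Relation.Nullary using (yes; no)
open import Algebra.Bundles using (CommutativeRing)
open import Algebra.Structures using (IsAbelianGroup)

record FiniteAbelianGroup : Set₁ where
  infixl 7 _∙_
  field
    Carrier        : Set
    _∙_            : Carrier → Carrier → Carrier
    ε              : Carrier
    _⁻¹            : Carrier → Carrier
    isAbelianGroup : IsAbelianGroup _≡_ _∙_ ε _⁻¹
    _≟_            : DecidableEquality Carrier
    size           : ℕ
    enum           : Fin size ↔ Carrier

module _ {c ℓ : Level} (R : CommutativeRing c ℓ) where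
  open CommutativeRing R using (_≈_; _+_; _*_; _-_; 0#; 1#) renaming (Carrier to C)

  sumFin : (n : ℕ) → (Fin n → C) → C
  sumFin zero    f = 0#
  sumFin (suc n) f = f zero + sumFin n (λ i → f (suc i))

  module _ (M : FiniteAbelianGroup) where
    open FiniteAbelianGroup M renaming (Carrier to G)

    sumM : (G → C) → C
    sumM f = sumFin size (λ i → f (Inverse.to enum i))

    δ : G → C
    δ α with α ≟ ε
    ... | yes _ = 1#
    ... | no  _ = 0#

    -- convolution (f ∗ g)(α) = ∑_{α = βγ} f(β) g(γ) = ∑_β f(β) g(β⁻¹α)
    -- (in a group, each β determines γ = β⁻¹α uniquely)
    _✶_ : (G → C) → (G → C) → (G → C)
    (f ✶ g) α = sumM (λ β → f β * g (β ⁻¹ ∙ α))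

    J* : (G → G → C) → G → G → C
    J* J α β = J α β - δ α - δ β

    record IsJacobi (J : G → G → C) : Set (c Level.⊔ ℓ) where
      field
        symm  : ∀ α β → J α β ≈ J β α
        cocyc : ∀ α β γ → J* J α β * J* J (α ∙ β) γ ≈ J* J α (β ∙ γ) * J* J β γ
        sumId : ∀ α₁ α₂ α₃ α₄ →
                sumM (λ β → J (α₁ ∙ β) (α₂ ∙ β ⁻¹) * J (α₃ ∙ β) (α₄ ∙ β ⁻¹))
                  ≈ J (α₁ ∙ α₄) (α₂ ∙ α₃)

    Q : (G → G → C) → G → G → C
    Q J α β = J (α ∙ β ⁻¹) β

{-# OPTIONS --safe #-}
module Submission where

-- Expanding the convolution, the summand of (Q_α ∗ Q_β)(γ) at δ is
-- J(αδ⁻¹, δ) J(βγ⁻¹δ, γδ⁻¹); after flipping the first factor by symmetry this is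
-- the summand of the sum rule (C) with (α₁, α₂, α₃, α₄) = (1, α, βγ⁻¹, γ),
-- which collapses the sum to J(γ, αβγ⁻¹) = Q_{αβ}(γ).

open import Defs
open import Level using (Level; 0ℓ)
open import Algebra.Bundles using (CommutativeRing; Group)
open import Algebra.Structures using (IsAbelianGroup)
open import Data.Nat using (zero; suc)
open import Data.Fin using (Fin; zero; suc)
open import Function.Bundles using (Inverse)
import Relation.Binary.PropositionalEquality as ≡
import Algebra.Properties.Group as GroupProperties
import Relation.Binary.Reasoning.Setoid as SetoidReasoning

module _ {g ℓ : Level} (G : Group g ℓ) where
  open Group G
  open GroupProperties G using (⁻¹-anti-homo-∙; ⁻¹-involutive)
  open SetoidReasoning setoid

  x∙[y⁻¹∙z]⁻¹≈x∙z⁻¹∙y : ∀ x y z → x ∙ (y ⁻¹ ∙ z) ⁻¹ ≈ x ∙ z ⁻¹ ∙ y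
  x∙[y⁻¹∙z]⁻¹≈x∙z⁻¹∙y x y z = begin
    x ∙ (y ⁻¹ ∙ z) ⁻¹      ≈⟨ ∙-congˡ (⁻¹-anti-homo-∙ (y ⁻¹) z) ⟩
    x ∙ (z ⁻¹ ∙ y ⁻¹ ⁻¹)   ≈⟨ ∙-congˡ (∙-congˡ (⁻¹-involutive y)) ⟩
    x ∙ (z ⁻¹ ∙ y)         ≈⟨ assoc x (z ⁻¹) y ⟨
    x ∙ z ⁻¹ ∙ y           ∎

module _ {c ℓ : Level} (R : CommutativeRing c ℓ) where
  open CommutativeRing R using (_≈_; refl; +-cong) renaming (Carrier to C)

  sumFin-cong : ∀ n {f g : Fin n → C} → (∀ i → f i ≈ g i) → sumFin R n f ≈ sumFin R n g
  sumFin-cong zero    f≈g = refl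
  sumFin-cong (suc n) f≈g = +-cong (f≈g zero) (sumFin-cong n (λ i → f≈g (suc i)))

  sumM-cong : ∀ M {f g : FiniteAbelianGroup.Carrier M → C} → (∀ x → f x ≈ g x) →
              sumM R M f ≈ sumM R M g
  sumM-cong M f≈g = sumFin-cong size (λ i → f≈g (Inverse.to enum i))
    where open FiniteAbelianGroup M using (size; enum)

group : FiniteAbelianGroup → Group 0ℓ 0ℓ
group M = record { isGroup = IsAbelianGroup.isGroup (FiniteAbelianGroup.isAbelianGroup M) }

module _ {c ℓ : Level} (R : CommutativeRing c ℓ) (M : FiniteAbelianGroup)
         {J : FiniteAbelianGroup.Carrier M → FiniteAbelianGroup.Carrier M → CommutativeRing.Carrier R}
         (isJacobi : IsJacobi R M J) where
  open CommutativeRing R using (_≈_; _*_; *-cong; reflexive; trans)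
  open FiniteAbelianGroup M
  open IsAbelianGroup isAbelianGroup using (identityˡ; comm)
  open IsJacobi isJacobi using (symm)

  Q✶Q-summand≈sumId-summand : ∀ α β γ δ →
    Q R M J α δ * Q R M J β (δ ⁻¹ ∙ γ) ≈ J (ε ∙ δ) (α ∙ δ ⁻¹) * J (β ∙ γ ⁻¹ ∙ δ) (γ ∙ δ ⁻¹)
  Q✶Q-summand≈sumId-summand α β γ δ = *-cong
    (trans (symm (α ∙ δ ⁻¹) δ) (reflexive (≡.cong (λ x → J x (α ∙ δ ⁻¹)) (≡.sym (identityˡ δ)))))
    (reflexive (≡.cong₂ J (x∙[y⁻¹∙z]⁻¹≈x∙z⁻¹∙y (group M) β δ γ) (comm (δ ⁻¹) γ)))

lemma4p3 : {c ℓ : Level} (R : CommutativeRing c ℓ) (M : FiniteAbelianGroup)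
    (J : FiniteAbelianGroup.Carrier M → FiniteAbelianGroup.Carrier M → CommutativeRing.Carrier R) →
    IsJacobi R M J →
    ∀ α β γ →
    CommutativeRing._≈_ R
      (_✶_ R M (Q R M J α) (Q R M J β) γ)
      (Q R M J (FiniteAbelianGroup._∙_ M α β) γ)
lemma4p3 R M J isJacobi α β γ = begin
  _✶_ R M (Q R M J α) (Q R M J β) γ
    ≈⟨ sumM-cong R M (Q✶Q-summand≈sumId-summand R M isJacobi α β γ) ⟩
  sumM R M (λ δ → J (ε ∙ δ) (α ∙ δ ⁻¹) * J (β ∙ γ ⁻¹ ∙ δ) (γ ∙ δ ⁻¹))
    ≈⟨ sumId ε α (β ∙ γ ⁻¹) γ ⟩
  J (ε ∙ γ) (α ∙ (β ∙ γ ⁻¹))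
    ≈⟨ symm (ε ∙ γ) (α ∙ (β ∙ γ ⁻¹)) ⟩
  J (α ∙ (β ∙ γ ⁻¹)) (ε ∙ γ)
    ≡⟨ ≡.cong₂ J (≡.sym (assoc α β (γ ⁻¹))) (identityˡ γ) ⟩
  Q R M J (α ∙ β) γ ∎
  where
  open CommutativeRing R using (_*_; setoid)
  open FiniteAbelianGroup M
  open IsAbelianGroup isAbelianGroup using (assoc; identityˡ)
  open IsJacobi isJacobi using (symm; sumId)
  open SetoidReasoning setoid
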